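{- Let $C\equiv 0 \pmod{4}$. Then the set $G = \Gamma_1 \cup (\Gamma_2 \setminus \Gamma_3)$ is a congruence subgroup of $\mathrm{SL}_2(\mathbb{Z})$.
   Context: Here $\Gamma_1 := \Gamma^1(C) \cap \Gamma_0(2)$, $\Gamma_2 := \Gamma^1\left( \frac{C}{2} \right) \cap \Gamma^0(C)$, and $\Gamma_3 := \Gamma_0(2) \cup \Gamma^1(C)$, where $\Gamma^0(N)$ and $\Gamma^1(N)$ denote the "lower triangular" versions of $\Gamma_0(N)$ and $\Gamma_1(N)$ (i.e. $\Gamma^0(N)$: matrices in $\mathrm{SL}_2(\mathbb{Z})$ with upper-right entry $\equiv 0 \pmod N$; $\Gamma^1(N)$: matrices $\equiv \begin{pmatrix}1&0\\ *&1\end{pmatrix}\pmod N$). -}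

module Defs where

open import Data.Nat as ℕ using (ℕ; _/_)
open import Data.Integer using (ℤ; +_; _+_; _-_; _*_; -_; 1ℤ; 0ℤ)
open import Data.Integer.Divisibility using (_∣_)
open import Data.Product using (_×_; ∃-syntax)
open import Data.Sum using (_⊎_)
open import Relation.Nullary using (¬_)
open import Relation.Binary.PropositionalEquality using (_≡_)

-- 2x2 integer matrices ( a b ; c d )
record Mat : Set where
  constructor mat
  field
    a b c d : ℤ
open Mat public

det : Mat → ℤ
det m = a m * d m - b m * c m

SL2 : Mat → Set
SL2 m = det m ≡ 1ℤ

I₂ : Mat
I₂ = mat 1ℤ 0ℤ 0ℤ 1ℤ

_·_ : Mat → Mat → Mat
m · n = mat (a m * a n + b m * c n) (a m * b n + b m * d n)
            (c m * a n + d m * c n) (c m * b n + d m * d n)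

-- inverse of a determinant-one matrix
inv : Mat → Mat
inv m = mat (d m) (- b m) (- c m) (a m)

_≡_[mod_] : ℤ → ℤ → ℕ → Set
x ≡ y [mod N ] = (+ N) ∣ (x - y)

Γ₀ : ℕ → Mat → Set
Γ₀ N m = SL2 m × (c m ≡ 0ℤ [mod N ])

Γ⁰ : ℕ → Mat → Set
Γ⁰ N m = SL2 m × (b m ≡ 0ℤ [mod N ])

Γ¹ : ℕ → Mat → Set
Γ¹ N m = SL2 m × (a m ≡ 1ℤ [mod N ]) × (b m ≡ 0ℤ [mod N ]) × (d m ≡ 1ℤ [mod N ])

Γ : ℕ → Mat → Set
Γ N m = SL2 m × (a m ≡ 1ℤ [mod N ]) × (b m ≡ 0ℤ [mod N ])
              × (c m ≡ 0ℤ [mod N ]) × (d m ≡ 1ℤ [mod N ])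

-- subsets of SL_2(ℤ) given as predicates on matrices
IsSubgroup : (Mat → Set) → Set
IsSubgroup H = (∀ m → H m → SL2 m)
             × H I₂
             × (∀ m n → H m → H n → H (m · n))
             × (∀ m → H m → H (inv m))

IsCongruenceSubgroup : (Mat → Set) → Set
IsCongruenceSubgroup H = IsSubgroup H
  × ∃[ N ] ((1 ℕ.≤ N) × (∀ m → Γ N m → H m))

Γ₁' : ℕ → Mat → Set
Γ₁' C m = Γ¹ C m × Γ₀ 2 m

Γ₂' : ℕ → Mat → Set
Γ₂' C m = Γ¹ (C / 2) m × Γ⁰ C m

Γ₃' : ℕ → Mat → Set
Γ₃' C m = Γ₀ 2 m ⊎ Γ¹ C m

G : ℕ → Mat → Set
G C m = Γ₁' C m ⊎ (Γ₂' C m × ¬ Γ₃' C m)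

module Submission where

-- Write C = 4Q with Q ≥ 1.  We show that G(C) coincides with
--   H(Q) = { (a b ; c d) ∈ SL₂(ℤ) : b ≡ 0  and  a ≡ d ≡ 1 + 2Q·c  (mod 4Q) },
-- recorded with explicit quotients: a = 1 + 2Qc + 4Qy, b = 4Qx, d = 1 + 2Qc + 4Qz.
-- Since 2Q·c (mod 4Q) only depends on the parity of c, the elements of H(Q)
-- with c even are exactly those of Γ₁, and those with c odd lie in Γ₂ ∖ Γ₃.
-- Conversely an element of Γ₂ ∖ Γ₃ has c odd, and its determinant forces
-- a ≡ d (mod 4Q), which together with a, d ≢ 1 (mod 4Q) puts it in H(Q).
-- The set H(Q) is closed under products and inverses by polynomial
-- identities valid for every integer Q, and it visibly contains Γ(4Q).

open import Defs
open import Data.Nat using (ℕ; _<_)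
open import Data.Nat.Divisibility using (_∣_)

import Data.Nat as ℕ
import Data.Nat.DivMod as ℕ
import Data.Nat.Divisibility as ℕ
import Data.Nat.Properties as ℕ
open import Data.Integer
  using (ℤ; +_; 1ℤ; 0ℤ; _+_; _*_; _-_; -_; NonZero)
open import Data.Integer.DivMod using (_%_; _/_; n%d<d; a≡a%n+[a/n]*n)
open import Data.Integer.Divisibility.Signed using (divides; ∣ᵤ⇒∣; ∣⇒∣ᵤ)
open import Data.Integer.Properties using (pos-*; *-cancelˡ-≡)
open import Data.Integer.Tactic.RingSolver using (solve; solve-∀)
open import Data.List using (_∷_; [])
open import Data.Product using (_×_; _,_; proj₁; ∃-syntax)
open import Data.Sum using (inj₁; inj₂; _⊎_)
open import Data.Empty using (⊥-elim)
open import Relation.Nullary using (¬_)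
open import Relation.Binary.PropositionalEquality
  using (_≡_; _≢_; refl; sym; trans; cong; cong₂; module ≡-Reasoning)

open ≡-Reasoning

-- A congruence x ≡ y (mod N) amounts to an equation x = y + k·M, where M
-- is any integer expression for N; this is the form the ring solver uses.
cong⇒quotient : ∀ {N M} x y → + N ≡ M → x ≡ y [mod N ] → ∃[ k ] x ≡ y + k * M
cong⇒quotient {N} {M} x y N≡M x≡y with ∣ᵤ⇒∣ x≡y
... | divides k x-y≡kN = k , (begin
  x            ≡⟨ solve (x ∷ y ∷ []) ⟩
  y + (x - y)  ≡⟨ cong (λ e → y + e) x-y≡kN ⟩
  y + k * + N  ≡⟨ cong (λ n → y + k * n) N≡M ⟩
  y + k * M    ∎)

quotient⇒cong : ∀ {x N M} y k → + N ≡ M → x ≡ y + k * M → x ≡ y [mod N ]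
quotient⇒cong {x} {N} {M} y k N≡M x≡y+kM = ∣⇒∣ᵤ (divides k (begin
  x - y            ≡⟨ cong (_- y) x≡y+kM ⟩
  y + k * M - y    ≡⟨ solve (y ∷ k ∷ M ∷ []) ⟩
  k * M            ≡⟨ cong (k *_) (sym N≡M) ⟩
  k * + N          ∎))

parity : ∀ z → (∃[ k ] z ≡ + 2 * k) ⊎ (∃[ k ] z ≡ 1ℤ + + 2 * k)
parity z = byRemainder (z % + 2) (z / + 2) (n%d<d z (+ 2)) (a≡a%n+[a/n]*n z (+ 2))
  where
  byRemainder : ∀ r k → r < 2 → z ≡ + r + k * + 2
              → (∃[ k ] z ≡ + 2 * k) ⊎ (∃[ k ] z ≡ 1ℤ + + 2 * k)
  byRemainder 0 k _ z≡ = inj₁ (k , trans z≡ (solve (k ∷ [])))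
  byRemainder 1 k _ z≡ = inj₂ (k , trans z≡ (solve (k ∷ [])))
  byRemainder (ℕ.suc (ℕ.suc _)) _ (ℕ.s≤s (ℕ.s≤s ()))

odd≢even : ∀ k j → 1ℤ + + 2 * k ≢ + 2 * j
odd≢even k j odd≡even with ℕ.∣1⇒≡1 (∣⇒∣ᵤ (divides {+ 2} {1ℤ} (j - k) (begin
  1ℤ                          ≡⟨ solve (k ∷ []) ⟩
  1ℤ + + 2 * k - + 2 * k      ≡⟨ cong (_- + 2 * k) odd≡even ⟩
  + 2 * j - + 2 * k           ≡⟨ solve (j ∷ k ∷ []) ⟩
  (j - k) * + 2               ∎)))
... | ()

det-· : ∀ m n → det (m · n) ≡ det m * det n
det-· (mat a b c d) (mat a′ b′ c′ d′) = expand a b c d a′ b′ c′ d′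
  where
  expand : ∀ a b c d a′ b′ c′ d′ →
    (a * a′ + b * c′) * (c * b′ + d * d′) - (a * b′ + b * d′) * (c * a′ + d * c′)
      ≡ (a * d - b * c) * (a′ * d′ - b′ * c′)
  expand = solve-∀

det-inv : ∀ m → det (inv m) ≡ det m
det-inv (mat a b c d) = expand a b c d
  where
  expand : ∀ a b c d → d * a - (- b) * (- c) ≡ a * d - b * c
  expand = solve-∀

SL2-· : ∀ m n → SL2 m → SL2 n → SL2 (m · n)
SL2-· m n detm≡1 detn≡1 = trans (det-· m n) (cong₂ _*_ detm≡1 detn≡1)

SL2-inv : ∀ m → SL2 m → SL2 (inv m)
SL2-inv m detm≡1 = trans (det-inv m) detm≡1

subgroup-≐ : ∀ {P R : Mat → Set} → (∀ m → P m → R m) → (∀ m → R m → P m)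
           → IsSubgroup R → IsSubgroup P
subgroup-≐ P⊆R R⊆P (R⊆SL2 , I₂∈R , R-· , R-inv) =
  (λ m m∈P → R⊆SL2 m (P⊆R m m∈P)) ,
  R⊆P I₂ I₂∈R ,
  (λ m n m∈P n∈P → R⊆P (m · n) (R-· m n (P⊆R m m∈P) (P⊆R n n∈P))) ,
  (λ m m∈P → R⊆P (inv m) (R-inv m (P⊆R m m∈P)))

H : ℤ → Mat → Set
H Q m = SL2 m × ∃[ x ] ∃[ y ] ∃[ z ]
    (a m ≡ 1ℤ + + 2 * Q * c m + + 4 * Q * y)
  × (b m ≡ + 4 * Q * x)
  × (d m ≡ 1ℤ + + 2 * Q * c m + + 4 * Q * z)

H-I₂ : ∀ Q → H Q I₂
H-I₂ Q = refl , 0ℤ , 0ℤ , 0ℤ , diagonal Q , off-diagonal Q , diagonal Q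
  where
  diagonal : ∀ Q → 1ℤ ≡ 1ℤ + + 2 * Q * 0ℤ + + 4 * Q * 0ℤ
  diagonal = solve-∀
  off-diagonal : ∀ Q → 0ℤ ≡ + 4 * Q * 0ℤ
  off-diagonal = solve-∀

-- Closure under products: the lower-left entry of the product is
-- c″ = c·a′ + d·c′, and the required forms of a″, b″, d″ are polynomial
-- identities in Q and the quotients.
H-· : ∀ Q m n → H Q m → H Q n → H Q (m · n)
H-· Q m@(mat _ _ c _) n@(mat _ _ c′ _)
    (detm≡1 , x , y , z , refl , refl , refl) (detn≡1 , x′ , y′ , z′ , refl , refl , refl) =
  SL2-· m n detm≡1 detn≡1 , _ , _ , _ ,
  a-entry Q c x y z c′ x′ y′ z′ , b-entry Q c x y z c′ x′ y′ z′ , d-entry Q c x y z c′ x′ y′ z′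
  where
  a-entry : ∀ Q c x y z c′ x′ y′ z′ →
    (1ℤ + + 2 * Q * c + + 4 * Q * y) * (1ℤ + + 2 * Q * c′ + + 4 * Q * y′) + + 4 * Q * x * c′
      ≡ 1ℤ + + 2 * Q * (c * (1ℤ + + 2 * Q * c′ + + 4 * Q * y′) + (1ℤ + + 2 * Q * c + + 4 * Q * z) * c′)
           + + 4 * Q * (y′ + y * (1ℤ + + 2 * Q * c′ + + 4 * Q * y′) + x * c′ - Q * c * c′ - + 2 * Q * z * c′)
  a-entry = solve-∀
  b-entry : ∀ Q c x y z c′ x′ y′ z′ →
    (1ℤ + + 2 * Q * c + + 4 * Q * y) * (+ 4 * Q * x′) + + 4 * Q * x * (1ℤ + + 2 * Q * c′ + + 4 * Q * z′)
      ≡ + 4 * Q * ((1ℤ + + 2 * Q * c + + 4 * Q * y) * x′ + x * (1ℤ + + 2 * Q * c′ + + 4 * Q * z′))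
  b-entry = solve-∀
  d-entry : ∀ Q c x y z c′ x′ y′ z′ →
    c * (+ 4 * Q * x′) + (1ℤ + + 2 * Q * c + + 4 * Q * z) * (1ℤ + + 2 * Q * c′ + + 4 * Q * z′)
      ≡ 1ℤ + + 2 * Q * (c * (1ℤ + + 2 * Q * c′ + + 4 * Q * y′) + (1ℤ + + 2 * Q * c + + 4 * Q * z) * c′)
           + + 4 * Q * (c * x′ + z + z′ * (1ℤ + + 2 * Q * c + + 4 * Q * z) - Q * c * c′ - + 2 * Q * c * y′)
  d-entry = solve-∀

-- Closure under inverses: inv m = (d, -b; -c, a), and 1 + 2Qc ≡ 1 - 2Qc (mod 4Q).
H-inv : ∀ Q m → H Q m → H Q (inv m)
H-inv Q m@(mat _ _ c _) (detm≡1 , x , y , z , refl , refl , refl) =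
  SL2-inv m detm≡1 , - x , z + c , y + c , swap Q c z , negate Q x , swap Q c y
  where
  swap : ∀ Q c y → 1ℤ + + 2 * Q * c + + 4 * Q * y ≡ 1ℤ + + 2 * Q * (- c) + + 4 * Q * (y + c)
  swap = solve-∀
  negate : ∀ Q x → - (+ 4 * Q * x) ≡ + 4 * Q * (- x)
  negate = solve-∀

H-isSubgroup : ∀ Q → IsSubgroup (H Q)
H-isSubgroup Q = (λ _ → proj₁) , H-I₂ Q , H-· Q , H-inv Q

cancel-2Q : ∀ Q .{{_ : NonZero Q}} {u v} → + 2 * Q * u ≡ + 2 * Q * v → u ≡ v
cancel-2Q Q {u} {v} 2Qu≡2Qv = *-cancelˡ-≡ (+ 2) u v (*-cancelˡ-≡ Q _ _ (begin
  Q * (+ 2 * u)  ≡⟨ solve (Q ∷ u ∷ []) ⟩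
  + 2 * Q * u    ≡⟨ 2Qu≡2Qv ⟩
  + 2 * Q * v    ≡⟨ solve (Q ∷ v ∷ []) ⟩
  Q * (+ 2 * v)  ∎))

module LevelFourQ {C : ℕ} {Q : ℤ} .{{_ : NonZero Q}}
             (C≡4Q : + C ≡ Q * + 4) (C/2≡2Q : + (C ℕ./ 2) ≡ Q * + 2) where

  even-diagonal : ∀ {u} k → u ≡ + 2 * k → (1ℤ + u * (Q * + 2)) ≡ 1ℤ [mod C ]
  even-diagonal k refl = quotient⇒cong 1ℤ k C≡4Q (begin
    1ℤ + + 2 * k * (Q * + 2)  ≡⟨ solve (Q ∷ k ∷ []) ⟩
    1ℤ + k * (Q * + 4)        ∎)

  odd-diagonal : ∀ {u c} k j → u ≡ 1ℤ + + 2 * k → c ≡ 1ℤ + + 2 * j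
               → 1ℤ + u * (Q * + 2) ≡ 1ℤ + + 2 * Q * c + + 4 * Q * (k - j)
  odd-diagonal k j refl refl = solve (Q ∷ k ∷ j ∷ [])

  -- 1 + 2Q·(odd) ≢ 1 (mod 4Q), because 2Q·(odd) is not a multiple of 4Q.
  odd-diagonal≢1 : ∀ k y j → 1ℤ + + 2 * Q * (1ℤ + + 2 * k) + + 4 * Q * y ≢ 1ℤ + j * (Q * + 4)
  odd-diagonal≢1 k y j a≡1+4Qj = odd≢even (k + y) j (cancel-2Q Q (begin
    + 2 * Q * (1ℤ + + 2 * (k + y))                    ≡⟨ solve (Q ∷ k ∷ y ∷ []) ⟩
    1ℤ + + 2 * Q * (1ℤ + + 2 * k) + + 4 * Q * y - 1ℤ  ≡⟨ cong (_- 1ℤ) a≡1+4Qj ⟩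
    1ℤ + j * (Q * + 4) - 1ℤ                          ≡⟨ solve (Q ∷ j ∷ []) ⟩
    + 2 * Q * (+ 2 * j)                               ∎))

  -- For a = 1 + 2Q·u, b = 4Q·x, d = 1 + 2Q·v, the condition ad - bc = 1
  -- reads 2Q(u + v) = 4Q(xc - Quv); hence u + v is even.
  det-parity : ∀ u v x c
             → (1ℤ + u * (Q * + 2)) * (1ℤ + v * (Q * + 2)) - (0ℤ + x * (Q * + 4)) * c ≡ 1ℤ
             → ∃[ n ] v ≡ + 2 * n - u
  det-parity u v x c det≡1 = x * c - Q * u * v , cancel-2Q Q (begin
    + 2 * Q * v
      ≡⟨ solve (Q ∷ u ∷ v ∷ x ∷ c ∷ []) ⟩
    (1ℤ + u * (Q * + 2)) * (1ℤ + v * (Q * + 2)) - (0ℤ + x * (Q * + 4)) * c - 1ℤ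
      + + 2 * Q * (+ 2 * (x * c - Q * u * v) - u)
      ≡⟨ cong (λ e → e - 1ℤ + + 2 * Q * (+ 2 * (x * c - Q * u * v) - u)) det≡1 ⟩
    1ℤ - 1ℤ + + 2 * Q * (+ 2 * (x * c - Q * u * v) - u)
      ≡⟨ solve (Q ∷ u ∷ v ∷ x ∷ c ∷ []) ⟩
    + 2 * Q * (+ 2 * (x * c - Q * u * v) - u)
      ∎)

  4Q-multiple : ∀ x → 0ℤ + x * (Q * + 4) ≡ + 4 * Q * x
  4Q-multiple x = solve (Q ∷ x ∷ [])

  upper-right : ∀ x → (+ 4 * Q * x) ≡ 0ℤ [mod C ]
  upper-right x = quotient⇒cong 0ℤ x C≡4Q (sym (4Q-multiple x))

  -- Γ₁ ⊆ H(Q): here c = 2k, so 2Q·c = 4Q·k can be absorbed into the quotient.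
  Γ₁⊆H : ∀ m → Γ₁' C m → H Q m
  Γ₁⊆H (mat a b c d) ((detm≡1 , a≡1 , b≡0 , d≡1) , (_ , c≡0))
    with cong⇒quotient a 1ℤ C≡4Q a≡1 | cong⇒quotient b 0ℤ C≡4Q b≡0
       | cong⇒quotient d 1ℤ C≡4Q d≡1 | cong⇒quotient c 0ℤ refl c≡0
  ... | y , refl | x , refl | z , refl | k , refl =
    detm≡1 , x , y - k , z - k , absorb y , 4Q-multiple x , absorb z
    where
    absorb : ∀ y → 1ℤ + y * (Q * + 4) ≡ 1ℤ + + 2 * Q * (0ℤ + k * + 2) + + 4 * Q * (y - k)
    absorb y = solve (Q ∷ k ∷ y ∷ [])

  -- Write a = 1 + 2Qu, d = 1 + 2Qv, b = 4Qx.  Not being in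
  -- Γ₀(2) forces c odd; u + v is even by the determinant, so u even would put
  -- the matrix in Γ¹(C).  Hence u, v, c are all odd and a, d ≡ 1 + 2Qc (mod 4Q).
  Γ₂∖Γ₃⊆H : ∀ m → Γ₂' C m → ¬ Γ₃' C m → H Q m
  Γ₂∖Γ₃⊆H (mat a b c d) ((detm≡1 , a≡1 , _ , d≡1) , (_ , b≡0)) ∉Γ₃
    with cong⇒quotient a 1ℤ C/2≡2Q a≡1 | cong⇒quotient b 0ℤ C≡4Q b≡0
       | cong⇒quotient d 1ℤ C/2≡2Q d≡1
  ... | u , refl | x , refl | v , refl
    with det-parity u v x c detm≡1 | parity c | parity u
  ... | _ | inj₁ (j , refl) | _ =
    ⊥-elim (∉Γ₃ (inj₁ (detm≡1 , quotient⇒cong 0ℤ j refl (begin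
      + 2 * j       ≡⟨ solve (j ∷ []) ⟩
      0ℤ + j * + 2  ∎))))
  ... | n , v≡2n-u | inj₂ _ | inj₁ (k , refl) =
    ⊥-elim (∉Γ₃ (inj₂ (detm≡1 , even-diagonal k refl , b≡0 , even-diagonal _ (begin
      v                   ≡⟨ v≡2n-u ⟩
      + 2 * n - + 2 * k   ≡⟨ solve (n ∷ k ∷ []) ⟩
      + 2 * (n - k)       ∎))))
  ... | n , v≡2n-u | inj₂ (j , refl) | inj₂ (k , refl) =
    detm≡1 , x , k - j , n - 1ℤ - k - j , odd-diagonal k j refl refl , 4Q-multiple x ,
    odd-diagonal (n - 1ℤ - k) j (begin
      v                            ≡⟨ v≡2n-u ⟩
      + 2 * n - (1ℤ + + 2 * k)     ≡⟨ solve (n ∷ k ∷ []) ⟩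
      1ℤ + + 2 * (n - 1ℤ - k)      ∎) refl

  G⊆H : ∀ m → G C m → H Q m
  G⊆H m (inj₁ m∈Γ₁)         = Γ₁⊆H m m∈Γ₁
  G⊆H m (inj₂ (m∈Γ₂ , ∉Γ₃)) = Γ₂∖Γ₃⊆H m m∈Γ₂ ∉Γ₃

  -- H(Q) ⊆ G(C), split by the parity of c: for c even the matrix is in Γ₁;
  -- for c odd it is in Γ₂, and outside Γ₃ since c is odd and a ≢ 1 (mod 4Q).
  H⊆G : ∀ m → H Q m → G C m
  H⊆G m@(mat _ _ c _) (detm≡1 , x , y , z , refl , refl , refl) with parity c
  ... | inj₁ (k , refl) =
    inj₁ ((detm≡1 , diagonal≡1 y , upper-right x , diagonal≡1 z) ,
          (detm≡1 , quotient⇒cong 0ℤ k refl (begin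
            + 2 * k       ≡⟨ solve (k ∷ []) ⟩
            0ℤ + k * + 2  ∎)))
    where
    diagonal≡1 : ∀ y → (1ℤ + + 2 * Q * (+ 2 * k) + + 4 * Q * y) ≡ 1ℤ [mod C ]
    diagonal≡1 y = quotient⇒cong 1ℤ (k + y) C≡4Q (begin
      1ℤ + + 2 * Q * (+ 2 * k) + + 4 * Q * y  ≡⟨ solve (Q ∷ k ∷ y ∷ []) ⟩
      1ℤ + (k + y) * (Q * + 4)                ∎)
  ... | inj₂ (k , refl) =
    inj₂ (((detm≡1 , diagonal≡1 y , upper-right′ , diagonal≡1 z) , (detm≡1 , upper-right x)) ,
          ∉Γ₃)
    where
    diagonal≡1 : ∀ y → (1ℤ + + 2 * Q * (1ℤ + + 2 * k) + + 4 * Q * y) ≡ 1ℤ [mod C ℕ./ 2 ]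
    diagonal≡1 y = quotient⇒cong 1ℤ (1ℤ + + 2 * (k + y)) C/2≡2Q (begin
      1ℤ + + 2 * Q * (1ℤ + + 2 * k) + + 4 * Q * y  ≡⟨ solve (Q ∷ k ∷ y ∷ []) ⟩
      1ℤ + (1ℤ + + 2 * (k + y)) * (Q * + 2)         ∎)
    upper-right′ : (+ 4 * Q * x) ≡ 0ℤ [mod C ℕ./ 2 ]
    upper-right′ = quotient⇒cong 0ℤ (+ 2 * x) C/2≡2Q (begin
      + 4 * Q * x              ≡⟨ solve (Q ∷ x ∷ []) ⟩
      0ℤ + + 2 * x * (Q * + 2)  ∎)
    ∉Γ₃ : ¬ Γ₃' C m
    ∉Γ₃ (inj₁ (_ , c≡0)) with cong⇒quotient (1ℤ + + 2 * k) 0ℤ refl c≡0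
    ... | j , c≡2j = odd≢even k j (begin
      1ℤ + + 2 * k   ≡⟨ c≡2j ⟩
      0ℤ + j * + 2   ≡⟨ solve (j ∷ []) ⟩
      + 2 * j        ∎)
    ∉Γ₃ (inj₂ (_ , a≡1 , _)) with cong⇒quotient _ 1ℤ C≡4Q a≡1
    ... | j , a≡1+4Qj = odd-diagonal≢1 k y j a≡1+4Qj

  -- Γ(C) ⊆ G(C): such a matrix lies in Γ₁, as 2 divides C.
  Γ⊆G : ∀ m → Γ C m → G C m
  Γ⊆G (mat a b c d) (detm≡1 , a≡1 , b≡0 , c≡0 , d≡1) with cong⇒quotient c 0ℤ C≡4Q c≡0
  ... | k , refl = inj₁ ((detm≡1 , a≡1 , b≡0 , d≡1) , (detm≡1 , c-even))
    where
    c-even : (0ℤ + k * (Q * + 4)) ≡ 0ℤ [mod 2 ]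
    c-even = quotient⇒cong 0ℤ (k * Q * + 2) refl (begin
      0ℤ + k * (Q * + 4)      ≡⟨ solve (Q ∷ k ∷ []) ⟩
      0ℤ + k * Q * + 2 * + 2  ∎)

  G-isCongruenceSubgroup : 1 ℕ.≤ C → IsCongruenceSubgroup (G C)
  G-isCongruenceSubgroup 1≤C = subgroup-≐ G⊆H H⊆G (H-isSubgroup Q) , C , 1≤C , Γ⊆G

half-of-4q : ∀ q → q ℕ.* 4 ℕ./ 2 ≡ q ℕ.* 2
half-of-4q q = trans (cong (ℕ._/ 2) (sym (ℕ.*-assoc q 2 2))) (ℕ.m*n/n≡m (q ℕ.* 2) 2)

lemma3p1 : (C : ℕ) → 0 < C → 4 ∣ C → IsCongruenceSubgroup (G C)
lemma3p1 .(0 ℕ.* 4) () (ℕ.divides 0 refl)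
lemma3p1 .(q ℕ.* 4) 0<C (ℕ.divides q@(ℕ.suc _) refl) =
  LevelFourQ.G-isCongruenceSubgroup {Q = + q} C≡4q C/2≡2q 0<C
  where
  C≡4q : + (q ℕ.* 4) ≡ + q * + 4
  C≡4q = pos-* q 4
  C/2≡2q : + (q ℕ.* 4 ℕ./ 2) ≡ + q * + 2
  C/2≡2q = trans (cong +_ (half-of-4q q)) (pos-* q 2)
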